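{- Let $T_n$ be a tree on $n \ge 2$ vertices. Then $\textrm{RED:LD}(T_n) \ge \lceil (2n+2)/3 \rceil$.
   Context: $N(v)$ denotes the open neighborhood of $v$. A set $S \subseteq V(G)$ is a locating-dominating (LD) set if for all $u,v \in V(G)-S$: $N(v)\cap S \neq \varnothing$, and if $u \ne v$ then $N(v) \cap S \neq N(u) \cap S$. A RED:LD set is an LD set $S$ such that $S-\{v\}$ is an LD set for every $v \in S$. $\textrm{RED:LD}(G)$ is the minimum cardinality of a RED:LD set of $G$. -}

module Defs where

open import Data.Nat using (ℕ; suc; _+_; _*_; _≤_)
open import Data.Nat.DivMod using (_/_)
open import Data.Bool using (Bool; true; false; _∧_)
open import Data.Fin using (Fin)
open import Data.Fin.Subset using (Subset; _∈_; _∉_; _-_; ∣_∣; Nonempty)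
open import Data.Vec using (lookup; tabulate)
open import Data.List using (List; []; _∷_; _++_; length)
open import Data.List.Relation.Unary.Unique.Propositional using (Unique)
open import Data.List.Relation.Unary.Linked using (Linked)
open import Data.Product using (Σ; _×_)
open import Relation.Binary.PropositionalEquality using (_≡_; _≢_)
open import Relation.Nullary using (¬_)

record Graph (n : ℕ) : Set where
  field
    adj   : Fin n → Fin n → Bool
    sym   : ∀ u v → adj u v ≡ adj v u
    loopless : ∀ v → adj v v ≡ false

module _ {n : ℕ} (G : Graph n) where
  open Graph G

  Adj : Fin n → Fin n → Set
  Adj u v = adj u v ≡ true

  data Walk : Fin n → Fin n → Set where
    here  : ∀ {u} → Walk u u
    step  : ∀ {u w v} → Adj u w → Walk w v → Walk u v

  Connected : Set
  Connected = ∀ u v → Walk u v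

  Cycle : Set
  Cycle = Σ (Fin n) λ x → Σ (Fin n) λ y → Σ (List (Fin n)) λ ys →
            (1 ≤ length ys) × Unique (x ∷ y ∷ ys) × Linked Adj (x ∷ y ∷ ys ++ x ∷ [])

  Acyclic : Set
  Acyclic = ¬ Cycle

  IsTree : Set
  IsTree = Connected × Acyclic

  NS : Subset n → Fin n → Subset n
  NS S v = tabulate λ u → lookup S u ∧ adj v u

  IsLD : Subset n → Set
  IsLD S = (∀ v → v ∉ S → Nonempty (NS S v))
         × (∀ u v → u ∉ S → v ∉ S → u ≢ v → NS S u ≢ NS S v)

  IsREDLD : Subset n → Set
  IsREDLD S = IsLD S × (∀ v → v ∈ S → IsLD (S - v))

  IsREDLDNumber : ℕ → Set
  IsREDLDNumber k = (Σ (Subset n) λ S → IsREDLD S × ∣ S ∣ ≡ k)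
                  × (∀ S → IsREDLD S → k ≤ ∣ S ∣)

⌈_/3⌉ : ℕ → ℕ
⌈ m /3⌉ = (m + 2) / 3

{-# OPTIONS --safe #-}
module Submission where

-- Let S be a RED:LD set, s = |S| and t = n - s. A vertex v ∉ S has two neighbours in S: it has
-- one, u, and v ∉ S - u must still be dominated by S - u. A vertex v ∈ S has a neighbour in S,
-- since v ∉ S - v is dominated by S - v. Splitting each degree by whether the neighbour lies in S,
--   Σ_v deg v = Σ_v |N(v) ∩ S| + Σ_{v ∉ S} deg v ≥ (s + 2t) + 2t.
-- A forest has degree sum at most 2(n - 1): a leaf exists, since otherwise a path can be extended
-- forever without repeating a vertex, and removing it costs 2. Hence s + 4t ≤ 2(s + t) - 2, i.e.
-- s ≥ 2t + 2, which is 3s ≥ 2n + 2.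

open import Defs
open import Data.Nat using (ℕ; zero; suc; _+_; _*_; _≤_; _<_; z≤n; s≤s; z<s; _≤?_)
open import Data.Nat.Properties
open import Data.Nat.DivMod using (m<n*o⇒m/o<n)
open import Data.Nat.Tactic.RingSolver using (solve-∀)
open import Data.Bool using (Bool; true; false; _∧_; not)
open import Data.Bool.Properties using (∧-conicalˡ; ∧-conicalʳ)
open import Data.Fin using (Fin; zero; suc; punchIn)
import Data.Fin.Properties as Fin
open import Data.Fin.Subset using (Subset; _∈_; _∉_; _⊆_; _-_; ⁅_⁆; ∣_∣)
open import Data.Fin.Subset.Properties using (p─q⊆p; x∈p∧x≢y⇒x∈p-y; x∈p⇒∣p-x∣<∣p∣)
open import Data.Vec using (_∷_; lookup; tabulate)
import Data.Vec as Vec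
open import Data.Vec.Properties using (lookup∘tabulate; tabulate∘lookup; []=⇒lookup; lookup⇒[]=)
open import Data.List using (List; []; _∷_; _++_; length; map)
import Data.List as List
open import Data.List.Properties using (map-++; length-map)
open import Data.List.Membership.Propositional using () renaming (_∈_ to _∈ₗ_)
open import Data.List.Membership.Propositional.Properties using (∈-lookup)
open import Data.List.Relation.Unary.All as All using (All; []; _∷_)
open import Data.List.Relation.Unary.All.Properties using (¬Any⇒All¬)
open import Data.List.Relation.Unary.Any using (here; there)
open import Data.List.Relation.Unary.Unique.Propositional using (Unique)
open import Data.List.Relation.Unary.AllPairs using ([]; _∷_)
import Data.List.Relation.Unary.Unique.Propositional.Properties as Unique
open import Data.List.Relation.Unary.Linked using (Linked; []; [-]; _∷_)
import Data.List.Relation.Unary.Linked.Properties as Linked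
open import Data.Product using (∃; _×_; _,_; proj₁; proj₂)
open import Data.Empty using (⊥-elim)
open import Function using (_∘_; case_of_; Injective)
open import Relation.Nullary using (yes; no)
open import Relation.Binary.PropositionalEquality
open import Algebra.Properties.CommutativeMonoid.Sum +-0-commutativeMonoid
  using (sum; sum-syntax; sum-cong-≗; sum-remove; ∑-distrib-+; ∑-comm)
open import Algebra.Properties.Semiring.Sum +-*-semiring using (*-distribˡ-sum)

⟦_⟧ : Bool → ℕ
⟦ true ⟧ = 1
⟦ false ⟧ = 0

⟦⟧≤1 : ∀ b → ⟦ b ⟧ ≤ 1
⟦⟧≤1 true = ≤-refl
⟦⟧≤1 false = z≤n

⟦∧⟧≤⟦⟧ : ∀ b c → ⟦ b ∧ c ⟧ ≤ ⟦ c ⟧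
⟦∧⟧≤⟦⟧ true c = ≤-refl
⟦∧⟧≤⟦⟧ false c = z≤n

⟦⟧-split : ∀ b c → ⟦ c ⟧ ≡ ⟦ b ∧ c ⟧ + ⟦ not b ⟧ * ⟦ c ⟧
⟦⟧-split true c = sym (+-identityʳ ⟦ c ⟧)
⟦⟧-split false c = sym (+-identityʳ ⟦ c ⟧)

sum-mono-≤ : ∀ {n} {f g : Fin n → ℕ} → (∀ i → f i ≤ g i) → sum f ≤ sum g
sum-mono-≤ {zero} f≤g = z≤n
sum-mono-≤ {suc n} f≤g = +-mono-≤ (f≤g zero) (sum-mono-≤ (f≤g ∘ suc))

∑⟦⟧-positive : ∀ {n} (f : Fin n → Bool) → 1 ≤ ∑[ i < n ] ⟦ f i ⟧ → ∃ λ i → f i ≡ true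
∑⟦⟧-positive {suc n} f pos with f zero in f0
... | true = zero , f0
... | false with ∑⟦⟧-positive (f ∘ suc) pos
...   | i , fi = suc i , fi

∑⟦⟧≥2⇒another-true : ∀ {n} (f : Fin n → Bool) → 2 ≤ ∑[ i < n ] ⟦ f i ⟧ → ∀ p →
                      ∃ λ i → f i ≡ true × i ≢ p
∑⟦⟧≥2⇒another-true {suc n} f 2≤∑ p =
  let i , fi = ∑⟦⟧-positive (f ∘ punchIn p) (≤-pred 2≤1+others) in
  punchIn p i , fi , Fin.punchInᵢ≢i p i
  where
  open ≤-Reasoning
  others = ∑[ i < n ] ⟦ f (punchIn p i) ⟧
  2≤1+others : 2 ≤ 1 + others
  2≤1+others = begin
    2                      ≤⟨ 2≤∑ ⟩
    ∑[ i < suc n ] ⟦ f i ⟧ ≡⟨ sum-remove {i = p} (⟦_⟧ ∘ f) ⟩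
    ⟦ f p ⟧ + others       ≤⟨ +-monoˡ-≤ others (⟦⟧≤1 (f p)) ⟩
    1 + others             ∎

∑⟦⟧+∑⟦not⟧≡n : ∀ {n} (f : Fin n → Bool) → ∑[ i < n ] ⟦ f i ⟧ + ∑[ i < n ] ⟦ not (f i) ⟧ ≡ n
∑⟦⟧+∑⟦not⟧≡n {zero} f = refl
∑⟦⟧+∑⟦not⟧≡n {suc n} f with f zero
... | true = cong suc (∑⟦⟧+∑⟦not⟧≡n (f ∘ suc))
... | false = trans (+-suc _ _) (cong suc (∑⟦⟧+∑⟦not⟧≡n (f ∘ suc)))

∣tabulate∣ : ∀ {n} (f : Fin n → Bool) → ∣ tabulate f ∣ ≡ ∑[ i < n ] ⟦ f i ⟧
∣tabulate∣ {zero} f = refl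
∣tabulate∣ {suc n} f with f zero
... | true = cong suc (∣tabulate∣ (f ∘ suc))
... | false = ∣tabulate∣ (f ∘ suc)

∣p∣≡∑ : ∀ {n} (p : Subset n) → ∣ p ∣ ≡ ∑[ i < n ] ⟦ lookup p i ⟧
∣p∣≡∑ p = trans (cong ∣_∣ (sym (tabulate∘lookup p))) (∣tabulate∣ (lookup p))

module _ {A : Set} where

  prefixTo : ∀ {y : A} {xs} → y ∈ₗ xs → List A
  prefixTo {xs = x ∷ _} (here _) = x ∷ []
  prefixTo {xs = x ∷ _} (there y∈xs) = x ∷ prefixTo y∈xs

  prefixTo-nonempty : ∀ {y : A} {xs} (y∈xs : y ∈ₗ xs) → 1 ≤ length (prefixTo y∈xs)
  prefixTo-nonempty (here _) = s≤s z≤n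
  prefixTo-nonempty (there _) = s≤s z≤n

  All-prefixTo : ∀ {P : A → Set} {y xs} → All P xs → (y∈xs : y ∈ₗ xs) → All P (prefixTo y∈xs)
  All-prefixTo (px ∷ _) (here _) = px ∷ []
  All-prefixTo (px ∷ pxs) (there y∈xs) = px ∷ All-prefixTo pxs y∈xs

  Unique-prefixTo : ∀ {y xs} → Unique xs → (y∈xs : y ∈ₗ xs) → Unique (prefixTo y∈xs)
  Unique-prefixTo (_ ∷ _) (here _) = [] ∷ []
  Unique-prefixTo (x∉ ∷ u) (there y∈xs) = All-prefixTo x∉ y∈xs ∷ Unique-prefixTo u y∈xs

  Linked-prefixTo : ∀ {R : A → A → Set} {c y a xs} → Linked R (c ∷ xs) →
                    (y∈xs : y ∈ₗ xs) → R y a → Linked R (c ∷ prefixTo y∈xs ++ a ∷ [])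
  Linked-prefixTo (Rcy ∷ _) (here refl) Rya = Rcy ∷ Rya ∷ [-]
  Linked-prefixTo (Rcx ∷ lk) (there y∈xs) Rya = Rcx ∷ Linked-prefixTo lk y∈xs Rya

  Unique⇒lookup-injective : ∀ {xs : List A} → Unique xs → Injective _≡_ _≡_ (List.lookup xs)
  Unique⇒lookup-injective (_ ∷ _) {zero} {zero} _ = refl
  Unique⇒lookup-injective (x∉ ∷ _) {zero} {suc j} eq = ⊥-elim (All.lookup x∉ (∈-lookup j) eq)
  Unique⇒lookup-injective (x∉ ∷ _) {suc i} {zero} eq = ⊥-elim (All.lookup x∉ (∈-lookup i) (sym eq))
  Unique⇒lookup-injective (_ ∷ u) {suc i} {suc j} eq = cong suc (Unique⇒lookup-injective u eq)

Unique⇒length≤ : ∀ {n} {xs : List (Fin n)} → Unique xs → length xs ≤ n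
Unique⇒length≤ u = Fin.injective⇒≤ (Unique⇒lookup-injective u)

module _ {n : ℕ} (G : Graph n) where
  open Graph G using (adj; loopless)

  degree : Fin n → ℕ
  degree v = ∑[ u < n ] ⟦ adj v u ⟧

  degreeSum : ℕ
  degreeSum = ∑[ v < n ] degree v

  Adj-sym : ∀ {u v} → Adj G u v → Adj G v u
  Adj-sym {u} {v} u~v = trans (Graph.sym G v u) u~v

  Adj-irrefl : ∀ {u v} → Adj G u v → u ≢ v
  Adj-irrefl {u} u~u refl with trans (sym u~u) (loopless u)
  ... | ()

  another-neighbour : ∀ {v} → 2 ≤ degree v → ∀ p → ∃ λ y → Adj G v y × y ≢ p
  another-neighbour {v} = ∑⟦⟧≥2⇒another-true (adj v)

  back-edge⇒cycle : ∀ {a b y rest} → Unique (a ∷ b ∷ rest) → Linked (Adj G) (a ∷ b ∷ rest) →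
                     Adj G a y → y ∈ₗ rest → Cycle G
  back-edge⇒cycle {a} {b} ((a≢b ∷ a∉) ∷ b∉ ∷ u) (a~b ∷ lk) a~y y∈rest =
    a , b , prefixTo y∈rest , prefixTo-nonempty y∈rest ,
    ((a≢b ∷ All-prefixTo a∉ y∈rest) ∷ All-prefixTo b∉ y∈rest ∷ Unique-prefixTo u y∈rest) ,
    a~b ∷ Linked-prefixTo lk y∈rest (Adj-sym a~y)

  module _ (minDegree≥2 : ∀ v → 2 ≤ degree v) where
    open import Data.List.Membership.DecPropositional (Fin._≟_ {n}) using (_∈?_)

    extend-path-to-cycle : ∀ fuel a b rest → Unique (a ∷ b ∷ rest) → Linked (Adj G) (a ∷ b ∷ rest) →
                 n < fuel + length (a ∷ b ∷ rest) → Cycle G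
    extend-path-to-cycle zero a b rest u _ n<len = ⊥-elim (<⇒≱ n<len (Unique⇒length≤ u))
    extend-path-to-cycle (suc fuel) a b rest u lk n<len with another-neighbour (minDegree≥2 a) b
    ... | y , a~y , y≢b with y ∈? rest
    ...   | yes y∈rest = back-edge⇒cycle u lk a~y y∈rest
    ...   | no y∉rest =
      extend-path-to-cycle fuel y a (b ∷ rest) (y∉path ∷ u) (Adj-sym a~y ∷ lk)
                 (subst (n <_) (sym (+-suc fuel _)) n<len)
      where
      y∉path : All (y ≢_) (a ∷ b ∷ rest)
      y∉path = (Adj-irrefl a~y ∘ sym) ∷ y≢b ∷ ¬Any⇒All¬ rest y∉rest

  minDegree≥2⇒cycle : Fin n → (∀ v → 2 ≤ degree v) → Cycle G
  minDegree≥2⇒cycle x minDegree≥2 with another-neighbour (minDegree≥2 x) x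
  ... | y , x~y , y≢x =
    extend-path-to-cycle minDegree≥2 n y x [] ((y≢x ∷ []) ∷ [] ∷ []) (Adj-sym x~y ∷ [-]) (m<m+n n z<s)

  acyclic⇒leaf : Acyclic G → Fin n → ∃ λ v → degree v ≤ 1
  acyclic⇒leaf acyclic x with Fin.any? (λ v → degree v ≤? 1)
  ... | yes leaf = leaf
  ... | no ¬leaf = ⊥-elim (acyclic (minDegree≥2⇒cycle x (λ v → ≰⇒> (¬leaf ∘ (v ,_)))))

module _ {n : ℕ} (G : Graph (suc n)) (ℓ : Fin (suc n)) where
  open Graph G using (adj; loopless)

  removeVertex : Graph n
  removeVertex = record
    { adj = λ u v → adj (punchIn ℓ u) (punchIn ℓ v)
    ; sym = λ u v → Graph.sym G (punchIn ℓ u) (punchIn ℓ v)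
    ; loopless = λ v → loopless (punchIn ℓ v)
    }

  removeVertex-acyclic : Acyclic G → Acyclic removeVertex
  removeVertex-acyclic acyclic (x , y , ys , 1≤len , u , lk) =
    acyclic (f x , f y , map f ys , subst (1 ≤_) (sym (length-map f ys)) 1≤len ,
             Unique.map⁺ (Fin.punchIn-injective ℓ _ _) u ,
             subst (Linked (Adj G)) (cong (λ zs → f x ∷ f y ∷ zs) (map-++ f ys (x ∷ []))) (Linked.map⁺ lk))
    where
    f = punchIn ℓ

  degree-punchIn : degree G ℓ ≡ ∑[ v < n ] ⟦ adj ℓ (punchIn ℓ v) ⟧
  degree-punchIn rewrite sum-remove {i = ℓ} (λ u → ⟦ adj ℓ u ⟧) | loopless ℓ = refl

  degreeSum-removeVertex : degreeSum G ≡ degree G ℓ + (degree G ℓ + degreeSum removeVertex)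
  degreeSum-removeVertex = begin
    degreeSum G
      ≡⟨ sum-remove {i = ℓ} (degree G) ⟩
    degree G ℓ + ∑[ v < n ] degree G (punchIn ℓ v)
      ≡⟨ cong (degree G ℓ +_) (sum-cong-≗ (λ v → sum-remove {i = ℓ} (λ u → ⟦ adj (punchIn ℓ v) u ⟧))) ⟩
    degree G ℓ + ∑[ v < n ] (⟦ adj (punchIn ℓ v) ℓ ⟧ + degree removeVertex v)
      ≡⟨ cong (degree G ℓ +_) (∑-distrib-+ (λ v → ⟦ adj (punchIn ℓ v) ℓ ⟧) (degree removeVertex)) ⟩
    degree G ℓ + (∑[ v < n ] ⟦ adj (punchIn ℓ v) ℓ ⟧ + degreeSum removeVertex)
      ≡⟨ cong (λ d → degree G ℓ + (d + degreeSum removeVertex)) ∑adj≡degree ⟩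
    degree G ℓ + (degree G ℓ + degreeSum removeVertex) ∎
    where
    open ≡-Reasoning
    ∑adj≡degree : ∑[ v < n ] ⟦ adj (punchIn ℓ v) ℓ ⟧ ≡ degree G ℓ
    ∑adj≡degree = trans (sum-cong-≗ (λ v → cong ⟦_⟧ (Graph.sym G (punchIn ℓ v) ℓ))) (sym degree-punchIn)

degreeSum-acyclic : ∀ {n} (G : Graph (suc n)) → Acyclic G → degreeSum G ≤ 2 * n
degreeSum-acyclic {zero} G _ rewrite Graph.loopless G zero = z≤n
degreeSum-acyclic {suc n} G acyclic with acyclic⇒leaf G acyclic zero
... | ℓ , leaf = begin
  degreeSum G                                               ≡⟨ degreeSum-removeVertex G ℓ ⟩
  degree G ℓ + (degree G ℓ + degreeSum (removeVertex G ℓ))  ≤⟨ +-mono-≤ leaf (+-mono-≤ leaf forest) ⟩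
  2 + 2 * n                                                 ≡⟨ *-suc 2 n ⟨
  2 * suc n                                                 ∎
  where
  open ≤-Reasoning
  forest = degreeSum-acyclic (removeVertex G ℓ) (removeVertex-acyclic G ℓ acyclic)

x∉p-x : ∀ {n} (p : Subset n) x → x ∉ p - x
x∉p-x (_ ∷ p) zero ()
x∉p-x (_ ∷ p) (suc x) (Vec.there x∈p-x) = x∉p-x p x x∈p-x

∈p-x⇒≢ : ∀ {n} {p : Subset n} {x y} → y ∈ p - x → y ≢ x
∈p-x⇒≢ {p = p} {x} y∈p-x refl = x∉p-x p x y∈p-x

∈⇒1≤∣∣ : ∀ {n} {p : Subset n} {x} → x ∈ p → 1 ≤ ∣ p ∣
∈⇒1≤∣∣ x∈p = ≤-trans (s≤s z≤n) (x∈p⇒∣p-x∣<∣p∣ x∈p)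

two-∈⇒2≤∣∣ : ∀ {n} {p : Subset n} {x y} → x ∈ p → y ∈ p → x ≢ y → 2 ≤ ∣ p ∣
two-∈⇒2≤∣∣ x∈p y∈p x≢y = ≤-trans (s≤s (∈⇒1≤∣∣ (x∈p∧x≢y⇒x∈p-y y∈p (x≢y ∘ sym)))) (x∈p⇒∣p-x∣<∣p∣ x∈p)

module _ {n : ℕ} (G : Graph n) where
  open Graph G using (adj)

  ∈NS⁻ : ∀ {S v u} → u ∈ NS G S v → u ∈ S × Adj G v u
  ∈NS⁻ {S} {v} {u} u∈NS = lookup⇒[]= u S (∧-conicalˡ _ _ u∈S∧v~u) , ∧-conicalʳ _ _ u∈S∧v~u
    where
    u∈S∧v~u : lookup S u ∧ adj v u ≡ true
    u∈S∧v~u = trans (sym (lookup∘tabulate _ u)) ([]=⇒lookup u∈NS)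

  ∈NS⁺ : ∀ {S v u} → u ∈ S → Adj G v u → u ∈ NS G S v
  ∈NS⁺ {S} {v} {u} u∈S v~u =
    lookup⇒[]= u (NS G S v) (trans (lookup∘tabulate _ u) (cong₂ _∧_ ([]=⇒lookup u∈S) v~u))

  NS-mono : ∀ {S S′ v} → S ⊆ S′ → NS G S v ⊆ NS G S′ v
  NS-mono S⊆S′ u∈NS = let u∈S , v~u = ∈NS⁻ u∈NS in ∈NS⁺ (S⊆S′ u∈S) v~u

  NS-remove : ∀ S w {v} → NS G (S - w) v ⊆ NS G S v
  NS-remove S w = NS-mono (p─q⊆p S ⁅ w ⁆)

  module _ {S : Subset n} (redLD : IsREDLD G S) where

    REDLD-∈⇒1≤∣NS∣ : ∀ {v} → v ∈ S → 1 ≤ ∣ NS G S v ∣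
    REDLD-∈⇒1≤∣NS∣ {v} v∈S =
      let u , u∈NS = proj₁ (proj₂ redLD v v∈S) v (x∉p-x S v) in
      ∈⇒1≤∣∣ (NS-remove S v u∈NS)

    REDLD-∉⇒2≤∣NS∣ : ∀ {v} → v ∉ S → 2 ≤ ∣ NS G S v ∣
    REDLD-∉⇒2≤∣NS∣ {v} v∉S =
      let u₁ , u₁∈NS = proj₁ (proj₁ redLD) v v∉S
          u₂ , u₂∈NS = proj₁ (proj₂ redLD u₁ (proj₁ (∈NS⁻ u₁∈NS))) v (v∉S ∘ p─q⊆p S _)
      in two-∈⇒2≤∣∣ (NS-remove S u₁ u₂∈NS) u₁∈NS (∈p-x⇒≢ (proj₁ (∈NS⁻ {S - u₁} u₂∈NS)))

module _ {n : ℕ} (G : Graph n) (S : Subset n) where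
  open Graph G using (adj)

  ∣NS∣≤degree : ∀ v → ∣ NS G S v ∣ ≤ degree G v
  ∣NS∣≤degree v = ≤-trans (≤-reflexive (∣tabulate∣ (λ u → lookup S u ∧ adj v u)))
                          (sum-mono-≤ (λ u → ⟦∧⟧≤⟦⟧ (lookup S u) (adj v u)))

  degreeSum-split : degreeSum G ≡ ∑[ v < n ] ∣ NS G S v ∣ + ∑[ v < n ] (⟦ not (lookup S v) ⟧ * degree G v)
  degreeSum-split = begin
    ∑[ v < n ] ∑[ u < n ] ⟦ adj v u ⟧
      ≡⟨ sum-cong-≗ (λ v → sum-cong-≗ (λ u → ⟦⟧-split (lookup S u) (adj v u))) ⟩
    ∑[ v < n ] ∑[ u < n ] (toS v u + toOutside v u)
      ≡⟨ sum-cong-≗ (λ v → ∑-distrib-+ (toS v) (toOutside v)) ⟩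
    ∑[ v < n ] (∑[ u < n ] toS v u + ∑[ u < n ] toOutside v u)
      ≡⟨ ∑-distrib-+ (λ v → ∑[ u < n ] toS v u) (λ v → ∑[ u < n ] toOutside v u) ⟩
    ∑[ v < n ] ∑[ u < n ] toS v u + ∑[ v < n ] ∑[ u < n ] toOutside v u
      ≡⟨ cong₂ _+_ (sum-cong-≗ (λ v → sym (∣tabulate∣ (λ u → lookup S u ∧ adj v u)))) (∑-comm toOutside) ⟩
    ∑[ v < n ] ∣ NS G S v ∣ + ∑[ u < n ] ∑[ v < n ] toOutside v u
      ≡⟨ cong₂ _+_ refl (sum-cong-≗ edges-into) ⟩
    ∑[ v < n ] ∣ NS G S v ∣ + ∑[ u < n ] (⟦ not (lookup S u) ⟧ * degree G u) ∎
    where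
    open ≡-Reasoning
    toS toOutside : Fin n → Fin n → ℕ
    toS v u = ⟦ lookup S u ∧ adj v u ⟧
    toOutside v u = ⟦ not (lookup S u) ⟧ * ⟦ adj v u ⟧
    edges-into : ∀ u → ∑[ v < n ] toOutside v u ≡ ⟦ not (lookup S u) ⟧ * degree G u
    edges-into u = begin
      ∑[ v < n ] (⟦ not (lookup S u) ⟧ * ⟦ adj v u ⟧)
        ≡⟨ sum-cong-≗ (λ v → cong (λ b → ⟦ not (lookup S u) ⟧ * ⟦ b ⟧) (Graph.sym G v u)) ⟩
      ∑[ v < n ] (⟦ not (lookup S u) ⟧ * ⟦ adj u v ⟧)
        ≡⟨ *-distribˡ-sum ⟦ not (lookup S u) ⟧ (λ v → ⟦ adj u v ⟧) ⟨
      ⟦ not (lookup S u) ⟧ * degree G u ∎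

  module _ (redLD : IsREDLD G S) where

    REDLD-vertex-bound : ∀ v → ⟦ lookup S v ⟧ + 4 * ⟦ not (lookup S v) ⟧ ≤
                              ∣ NS G S v ∣ + ⟦ not (lookup S v) ⟧ * degree G v
    REDLD-vertex-bound v with lookup S v in σv
    ... | true = ≤-trans (REDLD-∈⇒1≤∣NS∣ G redLD (lookup⇒[]= v S σv)) (m≤m+n _ 0)
    ... | false = +-mono-≤ 2≤∣NS∣ (≤-trans 2≤∣NS∣ (≤-trans (∣NS∣≤degree v) (m≤m+n _ 0)))
      where
      2≤∣NS∣ = REDLD-∉⇒2≤∣NS∣ G redLD (λ v∈S → case trans (sym ([]=⇒lookup v∈S)) σv of λ ())

    REDLD-degreeSum-lower-bound : ∑[ v < n ] ⟦ lookup S v ⟧ + 4 * ∑[ v < n ] ⟦ not (lookup S v) ⟧ ≤ degreeSum G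
    REDLD-degreeSum-lower-bound = begin
      ∑[ v < n ] ⟦ lookup S v ⟧ + 4 * ∑[ v < n ] ⟦ not (lookup S v) ⟧
        ≡⟨ cong₂ _+_ refl (*-distribˡ-sum 4 (λ v → ⟦ not (lookup S v) ⟧)) ⟩
      ∑[ v < n ] ⟦ lookup S v ⟧ + ∑[ v < n ] (4 * ⟦ not (lookup S v) ⟧)
        ≡⟨ ∑-distrib-+ (λ v → ⟦ lookup S v ⟧) (λ v → 4 * ⟦ not (lookup S v) ⟧) ⟨
      ∑[ v < n ] (⟦ lookup S v ⟧ + 4 * ⟦ not (lookup S v) ⟧)
        ≤⟨ sum-mono-≤ REDLD-vertex-bound ⟩
      ∑[ v < n ] (∣ NS G S v ∣ + ⟦ not (lookup S v) ⟧ * degree G v)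
        ≡⟨ ∑-distrib-+ (λ v → ∣ NS G S v ∣) (λ v → ⟦ not (lookup S v) ⟧ * degree G v) ⟩
      ∑[ v < n ] ∣ NS G S v ∣ + ∑[ v < n ] (⟦ not (lookup S v) ⟧ * degree G v)
        ≡⟨ degreeSum-split ⟨
      degreeSum G ∎
      where open ≤-Reasoning

⌈2n+2/3⌉≤s : ∀ s t m → s + 4 * t ≤ 2 * m → s + t ≡ suc m → ⌈ 2 * suc m + 2 /3⌉ ≤ s
⌈2n+2/3⌉≤s s t m s+4t≤2m s+t≡n = ≤-pred (m<n*o⇒m/o<n (begin-strict
  2 * suc m + 2 + 2           ≡⟨ cong (λ n → 2 * n + 2 + 2) s+t≡n ⟨
  2 * (s + t) + 2 + 2         ≡⟨ regroup₁ s t ⟩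
  s + s + (2 * t + 2) + 2     ≤⟨ +-monoˡ-≤ 2 (+-monoʳ-≤ (s + s) 2t+2≤s) ⟩
  s + s + s + 2               <⟨ n<1+n _ ⟩
  suc (s + s + s + 2)         ≡⟨ regroup₄ s ⟩
  suc s * 3                   ∎))
  where
  open ≤-Reasoning
  regroup₁ : ∀ s t → 2 * (s + t) + 2 + 2 ≡ s + s + (2 * t + 2) + 2
  regroup₁ = solve-∀
  regroup₂ : ∀ s t → s + 2 * t + (2 * t + 2) ≡ s + 4 * t + 2
  regroup₂ = solve-∀
  regroup₃ : ∀ s t → 2 * (s + t) ≡ s + 2 * t + s
  regroup₃ = solve-∀
  regroup₄ : ∀ s → suc (s + s + s + 2) ≡ suc s * 3
  regroup₄ = solve-∀
  2t+2≤s : 2 * t + 2 ≤ s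
  2t+2≤s = +-cancelˡ-≤ (s + 2 * t) _ _ (begin
    s + 2 * t + (2 * t + 2)   ≡⟨ regroup₂ s t ⟩
    s + 4 * t + 2             ≤⟨ +-monoˡ-≤ 2 s+4t≤2m ⟩
    2 * m + 2                 ≡⟨ +-comm (2 * m) 2 ⟩
    2 + 2 * m                 ≡⟨ *-suc 2 m ⟨
    2 * suc m                 ≡⟨ cong (2 *_) s+t≡n ⟨
    2 * (s + t)               ≡⟨ regroup₃ s t ⟩
    s + 2 * t + s             ∎)

theorem8 : (n : ℕ) → 2 ≤ n → (T : Graph n) → IsTree T →
    (k : ℕ) → IsREDLDNumber T k → ⌈ 2 * n + 2 /3⌉ ≤ k
theorem8 (suc m) _ T (_ , acyclic) k ((S , redLD , ∣S∣≡k) , _) =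
  subst (⌈ 2 * suc m + 2 /3⌉ ≤_) (trans (sym (∣p∣≡∑ S)) ∣S∣≡k)
    (⌈2n+2/3⌉≤s _ _ m (≤-trans (REDLD-degreeSum-lower-bound T S redLD) (degreeSum-acyclic T acyclic))
                      (∑⟦⟧+∑⟦not⟧≡n (lookup S)))
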